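{- Let $G$ be a graph with vertex set $\{v_1,\dots,v_n\}$, let $\mathbf F$ be a field and $m=wcdim(G,\mathbf F)$. Let $t_1,\dots,t_n\in\mathbb N$ and $H=G(t_1v_1,t_2v_2,\dots,t_nv_n)$. Then \[ wcdim(H,\mathbf F)=(m-n)+\sum_{i=1}^n t_i. \]
   Context: All graphs are finite, simple and undirected. An independent set of a graph $G$ is a set of pairwise non-adjacent vertices; it is maximal if it is not properly contained in another independent set. For a field $\mathbf F$, a well-covered weighting of $G$ is a function $w:V(G)\to\mathbf F$ such that $\sum_{x\in M}w(x)$ takes the same value for every maximal independent set $M$ of $G$. The well-covered weightings form an $\mathbf F$-vector space, whose dimension is denoted $wcdim(G,\mathbf F)$. For $t\in\mathbb N=\{1,2,\dots\}$ and $v\in V(G)$, the $t$-blowup $G(tv)$ is the graph obtained from $G$ by replacing $v$ with an independent set of $t$ new vertices, each adjacent exactly to the neighbours of $v$ in $G$. The multiple blowup $G(t_1v_1,\dots,t_nv_n)$ is obtained by performing the blowups $G(t_1v_1)$, then blowing up $v_2$ into $t_2$ vertices, and so on, successively for all $v_i$. -}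

module Defs where

open import Level using (Level; _⊔_) renaming (suc to lsuc)
open import Data.Nat using (ℕ; zero; suc) renaming (_+_ to _+ℕ_)
open import Data.Fin using (Fin; zero; suc; splitAt)
open import Data.Bool using (Bool; true; false; if_then_else_)
open import Data.Sum using (inj₁; inj₂)
open import Data.Product using (Σ; ∃; _×_; _,_)
open import Relation.Binary.PropositionalEquality using (_≡_)
open import Relation.Nullary using (¬_)
open import Algebra.Bundles using (CommutativeRing)

record Field (c ℓ : Level) : Set (lsuc (c ⊔ ℓ)) where
  field
    commutativeRing : CommutativeRing c ℓ
  open CommutativeRing commutativeRing public
  field
    0≉1     : ¬ (0# ≈ 1#)
    inverse : ∀ x → ¬ (x ≈ 0#) → ∃ λ y → (x * y) ≈ 1#

record Graph (n : ℕ) : Set where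
  field
    adj     : Fin n → Fin n → Bool
    symm    : ∀ i j → adj i j ≡ adj j i
    irrefl  : ∀ i → adj i i ≡ false
open Graph public

VSubset : ℕ → Set
VSubset n = Fin n → Bool

_⊆_ : ∀ {n} → VSubset n → VSubset n → Set
S ⊆ T = ∀ i → S i ≡ true → T i ≡ true

module _ {n : ℕ} (G : Graph n) where

  Independent : VSubset n → Set
  Independent S = ∀ i j → S i ≡ true → S j ≡ true → adj G i j ≡ false

  MaximalIndependent : VSubset n → Set
  MaximalIndependent S =
    Independent S × (∀ T → Independent T → S ⊆ T → T ⊆ S)

module _ {c ℓ : Level} (F : Field c ℓ) where
  open Field F using (Carrier; _≈_; _+_; _*_; 0#)

  fsum : ∀ {n} → (Fin n → Carrier) → Carrier
  fsum {zero}  f = 0#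
  fsum {suc n} f = f zero + fsum (λ i → f (suc i))

  weightOf : ∀ {n} → (Fin n → Carrier) → VSubset n → Carrier
  weightOf w S = fsum (λ i → if S i then w i else 0#)

  WellCovered : ∀ {n} → Graph n → (Fin n → Carrier) → Set ℓ
  WellCovered G w = ∀ M M' → MaximalIndependent G M → MaximalIndependent G M' →
                    weightOf w M ≈ weightOf w M'

  lincomb : ∀ {d n} → (Fin d → Carrier) → (Fin d → Fin n → Carrier) → Fin n → Carrier
  lincomb a b x = fsum (λ j → a j * b j x)

  IsWCBasis : ∀ {n d} → Graph n → (Fin d → Fin n → Carrier) → Set (c ⊔ ℓ)
  IsWCBasis G b =
    (∀ j → WellCovered G (b j)) ×
    (∀ a → (∀ x → lincomb a b x ≈ 0#) → ∀ j → a j ≈ 0#) ×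
    (∀ w → WellCovered G w → ∃ λ a → ∀ x → w x ≈ lincomb a b x)

  WcDim : ∀ {n} → Graph n → ℕ → Set (c ⊔ ℓ)
  WcDim G d = Σ (Fin d → Fin _ → Carrier) (IsWCBasis G)

sumℕ : ∀ {n} → (Fin n → ℕ) → ℕ
sumℕ {zero}  t = 0
sumℕ {suc n} t = t zero +ℕ sumℕ (λ i → t (suc i))

-- vertices of the blowup: Fin (Σ t_i), split into consecutive blocks of
-- sizes t_1,…,t_n; origin k is the vertex v_i whose copy k is.
origin : ∀ {n} (t : Fin n → ℕ) → Fin (sumℕ t) → Fin n
origin {zero}  t ()
origin {suc n} t k with splitAt (t zero) k
... | inj₁ _  = zero
... | inj₂ k' = suc (origin (λ i → t (suc i)) k')

-- two copies are adjacent iff their originals are adjacent in G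
-- (copies of the same vertex are non-adjacent since G is loopless).
blowup : ∀ {n} → Graph n → (t : Fin n → ℕ) → Graph (sumℕ t)
blowup G t = record
  { adj    = λ k l → adj G (origin t k) (origin t l)
  ; symm   = λ k l → symm G (origin t k) (origin t l)
  ; irrefl = λ k → irrefl G (origin t k)
  }

module Submission where

-- Write N = Σᵢ tᵢ and let fibreSum : F^N → F^n add up the weights of the
-- copies of each vertex.  Two facts combine:
--
-- * Combinatorics.  The blowup H is the pullback of G along the map
--   origin : V(H) → V(G), which has a section (the first copies).  Its
--   maximal independent sets are exactly the preimages of those of G,
--   and the weight of a preimage M ∘ origin under w equals the weight of
--   M under fibreSum w.  Hence w is well-covered on H iff fibreSum w is
--   well-covered on G.
--
-- * Linear algebra.  fibreSum is the projection of a splitting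
--   F^N = Q(F^n) ⊕ K(F^R), R = Σᵢ (tᵢ − 1), built blockwise from the
--   splitting of each block F^{tᵢ} along its total sum.  For any such
--   splitting, a basis b₁,…,bₘ of a subspace W ⊆ F^n gives the basis
--   Q b₁,…,Q bₘ, K e₁,…,K e_R of the preimage fibreSum⁻¹(W).
--
-- Applying the second fact to W = well-covered weightings of G yields
-- wcdim(H) = m + R, and (m + Σᵢ tᵢ) ∸ n = m + R is arithmetic.

open import Defs
open import Level using (Level; _⊔_)
import Data.Nat as Nat
open Nat using (ℕ; zero; suc)
open import Data.Fin using (Fin; zero; suc; _↑ˡ_; _↑ʳ_; splitAt; fromℕ<; _≟_)
open import Data.Fin.Properties using (splitAt-↑ˡ; splitAt-↑ʳ; join-splitAt)
open import Data.Sum using (inj₁; inj₂)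
open import Data.Sum.Properties using ([,]-∘)
open import Data.Product using (_×_; _,_; proj₁; ∃)
open import Data.Bool using (true; false; if_then_else_)
open import Data.Bool.Properties using (⇔→≡)
open import Data.Empty using (⊥-elim)
open import Data.Vec.Functional using (Vector; _++_; take; drop; map; zipWith)
open import Data.Vec.Functional.Properties using (lookup-++ˡ; lookup-++ʳ)
open import Data.Vec.Functional.Relation.Unary.All using (All)
import Data.Vec.Functional.Relation.Unary.All.Properties as All
open import Function using (_∘_; mk⇔)
import Relation.Binary.PropositionalEquality as ≡
open ≡ using (_≡_; _≗_)
open import Relation.Nullary using (yes; no; does)

module _ {a : Level} {A : Set a} where

  take-++-drop : ∀ m {n} (xs : Vector A (m Nat.+ n)) → take m xs ++ drop m xs ≗ xs
  take-++-drop m {n} xs i =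
    ≡.trans (≡.sym ([,]-∘ xs (splitAt m i))) (≡.cong xs (join-splitAt m n i))

  All-take-drop : ∀ {p} {P : A → Set p} m {n} (xs : Vector A (m Nat.+ n)) →
                  All P (take m xs) → All P (drop m xs) → All P xs
  All-take-drop {P = P} m xs pt pd i =
    ≡.subst P (take-++-drop m xs i) (All.++⁺ P pt pd i)

  map-++ : ∀ {m n} (f : A → A) (xs : Vector A m) (ys : Vector A n) →
           map f (xs ++ ys) ≗ map f xs ++ map f ys
  map-++ {m} f xs ys i with splitAt m i
  ... | inj₁ _ = ≡.refl
  ... | inj₂ _ = ≡.refl

  zipWith-++ : ∀ {m n} (f : A → A → A) (xs xs′ : Vector A m) (ys ys′ : Vector A n) →
               zipWith f (xs ++ ys) (xs′ ++ ys′) ≗ zipWith f xs xs′ ++ zipWith f ys ys′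
  zipWith-++ {m} f xs xs′ ys ys′ i with splitAt m i
  ... | inj₁ _ = ≡.refl
  ... | inj₂ _ = ≡.refl

  _⊕_ : ∀ {M₁ M₂ n₁ n₂} → (Vector A M₁ → Vector A n₁) → (Vector A M₂ → Vector A n₂) →
        Vector A (M₁ Nat.+ M₂) → Vector A (n₁ Nat.+ n₂)
  (L₁ ⊕ L₂) w = L₁ (take _ w) ++ L₂ (drop _ w)

module _ {n : ℕ} (G : Graph n) where

  NoNeighbourIn : VSubset n → Fin n → Set
  NoNeighbourIn S x = ∀ y → S y ≡ true → adj G x y ≡ false

  Dominating : VSubset n → Set
  Dominating S = ∀ x → NoNeighbourIn S x → S x ≡ true

  insert : Fin n → VSubset n → VSubset n
  insert x S y = if does (y ≟ x) then true else S y

  insert-independent : ∀ {S x} → Independent G S → NoNeighbourIn S x → Independent G (insert x S)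
  insert-independent {x = x} S-ind x-free y y′ y∈ y′∈ with y ≟ x | y′ ≟ x
  ... | yes ≡.refl | yes ≡.refl = irrefl G x
  ... | yes ≡.refl | no _       = x-free y′ y′∈
  ... | no _       | yes ≡.refl = ≡.trans (symm G y x) (x-free y y∈)
  ... | no _       | no _       = S-ind y y′ y∈ y′∈

  maximal⇒dominating : ∀ {S} → MaximalIndependent G S → Dominating S
  maximal⇒dominating {S} (S-ind , S-max) x x-free =
    S-max (insert x S) (insert-independent S-ind x-free) S⊆S∪x x x∈S∪x
    where
    S⊆S∪x : S ⊆ insert x S
    S⊆S∪x y y∈S with y ≟ x
    ... | yes _ = ≡.refl
    ... | no _  = y∈S
    x∈S∪x : insert x S x ≡ true
    x∈S∪x with x ≟ x
    ... | yes _  = ≡.refl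
    ... | no x≢x = ⊥-elim (x≢x ≡.refl)

  dominating⇒maximal : ∀ {S} → Independent G S → Dominating S → MaximalIndependent G S
  dominating⇒maximal S-ind S-dom = S-ind , λ T T-ind S⊆T x x∈T →
    S-dom x (λ y y∈S → T-ind x y x∈T (S⊆T y y∈S))

pullback : ∀ {n N} → Graph n → (Fin N → Fin n) → Graph N
pullback G π = record
  { adj    = λ k l → adj G (π k) (π l)
  ; symm   = λ k l → symm G (π k) (π l)
  ; irrefl = λ k → irrefl G (π k) }

module Pullback {n N} (G : Graph n) (π : Fin N → Fin n) (σ : Fin n → Fin N)
                (π∘σ : ∀ i → π (σ i) ≡ i) where

  H : Graph N
  H = pullback G π

  preimage-maximal : ∀ {M} → MaximalIndependent G M → MaximalIndependent H (M ∘ π)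
  preimage-maximal {M} M-max =
    dominating⇒maximal H (λ k l → proj₁ M-max (π k) (π l)) preimage-dominating
    where
    preimage-dominating : Dominating H (M ∘ π)
    preimage-dominating k k-free = maximal⇒dominating G M-max (π k) λ i i∈M →
      ≡.subst (λ j → adj G (π k) j ≡ false) (π∘σ i)
              (k-free (σ i) (≡.subst (λ j → M j ≡ true) (≡.sym (π∘σ i)) i∈M))

  module _ {M : VSubset N} (M-max : MaximalIndependent H M) where

    fibre-closed : ∀ {k l} → π k ≡ π l → M k ≡ true → M l ≡ true
    fibre-closed {k} {l} πk≡πl k∈M = maximal⇒dominating H M-max l λ y y∈M →
      ≡.subst (λ j → adj G j (π y) ≡ false) πk≡πl (proj₁ M-max k y k∈M y∈M)

    restriction : VSubset n
    restriction = M ∘ σ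

    preimage-restriction : M ≗ restriction ∘ π
    preimage-restriction k = ⇔→≡ (mk⇔
      (fibre-closed (≡.sym (π∘σ (π k))))
      (fibre-closed (π∘σ (π k))))

    restriction-maximal : MaximalIndependent G restriction
    restriction-maximal = dominating⇒maximal G restriction-independent restriction-dominating
      where
      restriction-independent : Independent G restriction
      restriction-independent i j i∈ j∈ =
        ≡.subst₂ (λ i′ j′ → adj G i′ j′ ≡ false) (π∘σ i) (π∘σ j) (proj₁ M-max (σ i) (σ j) i∈ j∈)
      restriction-dominating : Dominating G restriction
      restriction-dominating i i-free = maximal⇒dominating H M-max (σ i) λ y y∈M →
        ≡.subst (λ i′ → adj G i′ (π y) ≡ false) (≡.sym (π∘σ i))
                (i-free (π y) (≡.subst (λ b → b ≡ true) (preimage-restriction y) y∈M))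

origin-↑ˡ : ∀ {n} (t : Fin (suc n) → ℕ) k → origin t (k ↑ˡ sumℕ (t ∘ suc)) ≡ zero
origin-↑ˡ t k rewrite splitAt-↑ˡ (t zero) k (sumℕ (t ∘ suc)) = ≡.refl

origin-↑ʳ : ∀ {n} (t : Fin (suc n) → ℕ) k → origin t (t zero ↑ʳ k) ≡ suc (origin (t ∘ suc) k)
origin-↑ʳ t k rewrite splitAt-↑ʳ (t zero) (sumℕ (t ∘ suc)) k = ≡.refl

firstCopy : ∀ {n} (t : Fin n → ℕ) → (∀ i → 1 Nat.≤ t i) → Fin n → Fin (sumℕ t)
firstCopy t t≥1 zero    = fromℕ< (t≥1 zero) ↑ˡ sumℕ (t ∘ suc)
firstCopy t t≥1 (suc i) = t zero ↑ʳ firstCopy (t ∘ suc) (t≥1 ∘ suc) i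

origin-firstCopy : ∀ {n} (t : Fin n → ℕ) (t≥1 : ∀ i → 1 Nat.≤ t i) i →
                   origin t (firstCopy t t≥1 i) ≡ i
origin-firstCopy t t≥1 zero    = origin-↑ˡ t _
origin-firstCopy t t≥1 (suc i) =
  ≡.trans (origin-↑ʳ t _) (≡.cong suc (origin-firstCopy (t ∘ suc) (t≥1 ∘ suc) i))

excess : ∀ {n} → (Fin n → ℕ) → ℕ
excess t = sumℕ (λ i → Nat.pred (t i))

module LinearAlgebra {c ℓ : Level} (F : Field c ℓ) where

  open Field F hiding (zero)
  open import Algebra.Properties.Semiring.Sum semiring
    using (sum; sum-cong-≋; ∑-distrib-+; *-distribˡ-sum; sum-replicate-zero)
  open import Algebra.Properties.Ring ring using (-‿distribʳ-*; -‿+-comm)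
  open import Data.Vec.Functional.Relation.Binary.Equality.Setoid setoid
    using (_≋_; ≋-sym; ≋-trans; ++⁺)
  open import Relation.Binary.Reasoning.Setoid setoid

  Vec : ℕ → Set c
  Vec = Vector Carrier

  0ᵥ : ∀ {n} → Vec n
  0ᵥ _ = 0#

  infixl 6 _+ᵥ_
  infixr 7 _·ᵥ_

  _+ᵥ_ : ∀ {n} → Vec n → Vec n → Vec n
  _+ᵥ_ = zipWith _+_

  _·ᵥ_ : ∀ {n} → Carrier → Vec n → Vec n
  x ·ᵥ u = map (x *_) u

  ≗⇒≋ : ∀ {n} {u v : Vec n} → u ≗ v → u ≋ v
  ≗⇒≋ u≗v = reflexive ∘ u≗v

  fsum≡sum : ∀ {n} (f : Vec n) → fsum F f ≡ sum f
  fsum≡sum {zero}  f = ≡.refl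
  fsum≡sum {suc n} f = ≡.cong (f zero +_) (fsum≡sum (f ∘ suc))

  fsum-cong : ∀ {n} {f g : Vec n} → f ≋ g → fsum F f ≈ fsum F g
  fsum-cong {f = f} {g} f≋g rewrite fsum≡sum f | fsum≡sum g = sum-cong-≋ f≋g

  fsum-0 : ∀ {n} → fsum F (0ᵥ {n}) ≈ 0#
  fsum-0 {n} rewrite fsum≡sum (0ᵥ {n}) = sum-replicate-zero n

  fsum-+ : ∀ {n} (f g : Vec n) → fsum F (f +ᵥ g) ≈ fsum F f + fsum F g
  fsum-+ f g rewrite fsum≡sum (f +ᵥ g) | fsum≡sum f | fsum≡sum g = ∑-distrib-+ f g

  fsum-· : ∀ {n} x (f : Vec n) → fsum F (x ·ᵥ f) ≈ x * fsum F f
  fsum-· x f rewrite fsum≡sum (x ·ᵥ f) | fsum≡sum f = sym (*-distribˡ-sum x f)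

  fsum-++ : ∀ m {r} (f : Vec (m Nat.+ r)) →
            fsum F f ≈ fsum F (take m f) + fsum F (drop m f)
  fsum-++ zero    f = sym (+-identityˡ _)
  fsum-++ (suc m) f = begin
    f zero + fsum F (f ∘ suc)                                     ≈⟨ +-congˡ (fsum-++ m (f ∘ suc)) ⟩
    f zero + (fsum F (take m (f ∘ suc)) + fsum F (drop m (f ∘ suc))) ≈⟨ +-assoc _ _ _ ⟨
    fsum F (take (suc m) f) + fsum F (drop (suc m) f)            ∎

  record Linear {p q} (L : Vec p → Vec q) : Set (c ⊔ ℓ) where
    field
      preserves-≋ : ∀ {u v} → u ≋ v → L u ≋ L v
      preserves-+ : ∀ u v → L (u +ᵥ v) ≋ L u +ᵥ L v
      preserves-· : ∀ x u → L (x ·ᵥ u) ≋ x ·ᵥ L u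

    preserves-0 : L 0ᵥ ≋ 0ᵥ
    preserves-0 i = begin
      L 0ᵥ i            ≈⟨ preserves-≋ (λ _ → sym (zeroˡ 0#)) i ⟩
      L (0# ·ᵥ 0ᵥ) i    ≈⟨ preserves-· 0# 0ᵥ i ⟩
      0# * L 0ᵥ i       ≈⟨ zeroˡ _ ⟩
      0#                ∎

    preserves-lincomb : ∀ {d} (a : Vec d) (b : Fin d → Vec p) →
                        L (lincomb F a b) ≋ lincomb F a (L ∘ b)
    preserves-lincomb {zero}  a b = preserves-0
    preserves-lincomb {suc d} a b i = begin
      L (a zero ·ᵥ b zero +ᵥ lincomb F (a ∘ suc) (b ∘ suc)) i
        ≈⟨ preserves-+ _ _ i ⟩
      L (a zero ·ᵥ b zero) i + L (lincomb F (a ∘ suc) (b ∘ suc)) i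
        ≈⟨ +-cong (preserves-· (a zero) (b zero) i) (preserves-lincomb (a ∘ suc) (b ∘ suc) i) ⟩
      lincomb F a (L ∘ b) i ∎

  open Linear

  into-F⁰-linear : ∀ {p} (L : Vec p → Vec 0) → Linear L
  into-F⁰-linear L = record
    { preserves-≋ = λ _ () ; preserves-+ = λ _ _ () ; preserves-· = λ _ _ () }

  ⊕-linear : ∀ {M₁ M₂ n₁ n₂} {L₁ : Vec M₁ → Vec n₁} {L₂ : Vec M₂ → Vec n₂} →
             Linear L₁ → Linear L₂ → Linear (L₁ ⊕ L₂)
  ⊕-linear {M₁} {n₁ = n₁} lin₁ lin₂ = record
    { preserves-≋ = λ u≋v →
        ++⁺ _≈_ (preserves-≋ lin₁ (u≋v ∘ (_↑ˡ _))) (preserves-≋ lin₂ (u≋v ∘ (M₁ ↑ʳ_)))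
    ; preserves-+ = λ u v → ≋-trans (++⁺ _≈_ (preserves-+ lin₁ _ _) (preserves-+ lin₂ _ _))
                                    (≗⇒≋ (≡.sym ∘ zipWith-++ {m = n₁} _+_ _ _ _ _))
    ; preserves-· = λ x u → ≋-trans (++⁺ _≈_ (preserves-· lin₁ x _) (preserves-· lin₂ x _))
                                    (≗⇒≋ (≡.sym ∘ map-++ {m = n₁} (x *_) _ _))
    }

  ⊕-∘ : ∀ {M₁ M₂ m₁ m₂ n₁ n₂} {L₁ : Vec m₁ → Vec n₁} {L₂ : Vec m₂ → Vec n₂}
          (lin₁ : Linear L₁) (lin₂ : Linear L₂)
          (P₁ : Vec M₁ → Vec m₁) (P₂ : Vec M₂ → Vec m₂) (u : Vec (M₁ Nat.+ M₂)) →
        (L₁ ⊕ L₂) ((P₁ ⊕ P₂) u) ≋ ((L₁ ∘ P₁) ⊕ (L₂ ∘ P₂)) u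
  ⊕-∘ lin₁ lin₂ P₁ P₂ u = ++⁺ _≈_
    (preserves-≋ lin₁ (≗⇒≋ (lookup-++ˡ (P₁ (take _ u)) (P₂ (drop _ u)))))
    (preserves-≋ lin₂ (≗⇒≋ (lookup-++ʳ (P₁ (take _ u)) (P₂ (drop _ u)))))

  unit : ∀ {d} → Fin d → Vec d
  unit zero    zero    = 1#
  unit zero    (suc _) = 0#
  unit (suc j) zero    = 0#
  unit (suc j) (suc k) = unit j k

  lincomb-unit : ∀ {d} (z : Vec d) → lincomb F z unit ≋ z
  lincomb-unit {suc d} z zero = begin
    z zero * 1# + lincomb F (z ∘ suc) (unit ∘ suc) zero
      ≈⟨ +-cong (*-identityʳ _) (fsum-cong {d} (λ j → zeroʳ (z (suc j)))) ⟩
    z zero + fsum F (0ᵥ {d})  ≈⟨ +-congˡ (fsum-0 {d}) ⟩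
    z zero + 0#               ≈⟨ +-identityʳ _ ⟩
    z zero                    ∎
  lincomb-unit {suc d} z (suc k) = begin
    z zero * 0# + lincomb F (z ∘ suc) unit k ≈⟨ +-cong (zeroʳ _) (lincomb-unit (z ∘ suc) k) ⟩
    0# + z (suc k)                           ≈⟨ +-identityˡ _ ⟩
    z (suc k)                                ∎

  lincomb-congˡ : ∀ {d n} {a a′ : Vec d} (b : Fin d → Vec n) → a ≋ a′ →
                  lincomb F a b ≋ lincomb F a′ b
  lincomb-congˡ b a≋a′ x = fsum-cong (λ j → *-congʳ (a≋a′ j))

  lincomb-congʳ : ∀ {d n} (a : Vec d) {b b′ : Fin d → Vec n} → (∀ j → b j ≋ b′ j) →
                  lincomb F a b ≋ lincomb F a b′
  lincomb-congʳ a b≋b′ x = fsum-cong (λ j → *-congˡ (b≋b′ j x))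

  -- b is a basis of W ⊆ F^n; IsWCBasis F G b unfolds to IsBasis (WellCovered F G) b.
  IsBasis : ∀ {n d} → (Vec n → Set ℓ) → (Fin d → Vec n) → Set (c ⊔ ℓ)
  IsBasis W b = (∀ j → W (b j))
              × (∀ a → lincomb F a b ≋ 0ᵥ → a ≋ 0ᵥ)
              × (∀ w → W w → ∃ λ a → w ≋ lincomb F a b)

  -- A decomposition F^N = Q(F^n) ⊕ K(F^R) in which S : F^N → F^n is the
  -- projection onto the first summand along K(F^R) = ker S.
  record Splitting {N n} (S : Vec N → Vec n) (R : ℕ) : Set (c ⊔ ℓ) where
    field
      E : Vec N → Vec R
      Q : Vec n → Vec N
      K : Vec R → Vec N
      S-linear : Linear S
      E-linear : Linear E
      Q-linear : Linear Q
      K-linear : Linear K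
      S∘Q : ∀ u → S (Q u) ≋ u
      S∘K : ∀ z → S (K z) ≋ 0ᵥ
      E∘Q : ∀ u → E (Q u) ≋ 0ᵥ
      E∘K : ∀ z → E (K z) ≋ z
      Q∘S+K∘E : ∀ w → Q (S w) +ᵥ K (E w) ≋ w

  _⊕ˢ_ : ∀ {M₁ M₂ n₁ n₂ R₁ R₂} {S₁ : Vec M₁ → Vec n₁} {S₂ : Vec M₂ → Vec n₂} →
         Splitting S₁ R₁ → Splitting S₂ R₂ → Splitting (S₁ ⊕ S₂) (R₁ Nat.+ R₂)
  _⊕ˢ_ {M₁} {n₁ = n₁} {R₁ = R₁} {S₁ = S₁} {S₂ = S₂} s₁ s₂ = record
    { E = E s₁ ⊕ E s₂ ; Q = Q s₁ ⊕ Q s₂ ; K = K s₁ ⊕ K s₂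
    ; S-linear = ⊕-linear (S-linear s₁) (S-linear s₂)
    ; E-linear = ⊕-linear (E-linear s₁) (E-linear s₂)
    ; Q-linear = ⊕-linear (Q-linear s₁) (Q-linear s₂)
    ; K-linear = ⊕-linear (K-linear s₁) (K-linear s₂)
    ; S∘Q = λ u → ≋-trans (⊕-∘ (S-linear s₁) (S-linear s₂) (Q s₁) (Q s₂) u)
                          (blockwise-id {n₁} (S∘Q s₁) (S∘Q s₂) u)
    ; S∘K = λ z → ≋-trans (⊕-∘ (S-linear s₁) (S-linear s₂) (K s₁) (K s₂) z)
                          (All.++⁺ (_≈ 0#) (S∘K s₁ _) (S∘K s₂ _))
    ; E∘Q = λ u → ≋-trans (⊕-∘ (E-linear s₁) (E-linear s₂) (Q s₁) (Q s₂) u)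
                          (All.++⁺ (_≈ 0#) (E∘Q s₁ _) (E∘Q s₂ _))
    ; E∘K = λ z → ≋-trans (⊕-∘ (E-linear s₁) (E-linear s₂) (K s₁) (K s₂) z)
                          (blockwise-id {R₁} (E∘K s₁) (E∘K s₂) z)
    ; Q∘S+K∘E = λ w → ≋-trans
        (+ᵥ-cong (⊕-∘ (Q-linear s₁) (Q-linear s₂) S₁ S₂ w)
                 (⊕-∘ (K-linear s₁) (K-linear s₂) (E s₁) (E s₂) w))
        (≋-trans (≗⇒≋ (zipWith-++ {m = M₁} _+_ _ _ _ _))
                 (blockwise-id {M₁} (Q∘S+K∘E s₁) (Q∘S+K∘E s₂) w))
    }
    where
    open Splitting
    blockwise-id : ∀ {m r} {L₁ : Vec m → Vec m} {L₂ : Vec r → Vec r} →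
                   (∀ u → L₁ u ≋ u) → (∀ u → L₂ u ≋ u) → ∀ u → (L₁ ⊕ L₂) u ≋ u
    blockwise-id {m} id₁ id₂ u = ≋-trans (++⁺ _≈_ (id₁ _) (id₂ _)) (≗⇒≋ (take-++-drop m u))
    +ᵥ-cong : ∀ {k} {u u′ v v′ : Vec k} → u ≋ u′ → v ≋ v′ → u +ᵥ v ≋ u′ +ᵥ v′
    +ᵥ-cong u≋u′ v≋v′ i = +-cong (u≋u′ i) (v≋v′ i)

  module BasisTransfer {N n R} {S : Vec N → Vec n} (s : Splitting S R) where
    open Splitting s

    liftBasis : ∀ {m} → (Fin m → Vec n) → Fin (m Nat.+ R) → Vec N
    liftBasis b = (Q ∘ b) ++ (K ∘ unit)

    lincomb-liftBasis : ∀ {m} (b : Fin m → Vec n) (x : Vec (m Nat.+ R)) →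
      lincomb F x (liftBasis b) ≋ Q (lincomb F (take m x) b) +ᵥ K (drop m x)
    lincomb-liftBasis {m} b x y = begin
      lincomb F x (liftBasis b) y
        ≈⟨ fsum-++ m (λ j → x j * liftBasis b j y) ⟩
      lincomb F (take m x) (take m (liftBasis b)) y
        + lincomb F (drop m x) (drop m (liftBasis b)) y
        ≈⟨ +-cong (lincomb-congʳ (take m x) (λ j → ≗⇒≋ (≡.cong-app (lookup-++ˡ Qb Ke j))) y)
                  (lincomb-congʳ (drop m x) (λ j → ≗⇒≋ (≡.cong-app (lookup-++ʳ Qb Ke j))) y) ⟩
      lincomb F (take m x) (Q ∘ b) y + lincomb F (drop m x) (K ∘ unit) y
        ≈⟨ +-cong (preserves-lincomb Q-linear (take m x) b y)
                  (preserves-lincomb K-linear (drop m x) unit y) ⟨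
      Q (lincomb F (take m x) b) y + K (lincomb F (drop m x) unit) y
        ≈⟨ +-congˡ (preserves-≋ K-linear (lincomb-unit (drop m x)) y) ⟩
      Q (lincomb F (take m x) b) y + K (drop m x) y
        ∎
      where
      Qb = Q ∘ b
      Ke = K ∘ unit

    S-coordinate : ∀ u z → S (Q u +ᵥ K z) ≋ u
    S-coordinate u z i = begin
      S (Q u +ᵥ K z) i     ≈⟨ preserves-+ S-linear (Q u) (K z) i ⟩
      S (Q u) i + S (K z) i ≈⟨ +-cong (S∘Q u i) (S∘K z i) ⟩
      u i + 0#              ≈⟨ +-identityʳ _ ⟩
      u i                   ∎

    E-coordinate : ∀ u z → E (Q u +ᵥ K z) ≋ z
    E-coordinate u z i = begin
      E (Q u +ᵥ K z) i      ≈⟨ preserves-+ E-linear (Q u) (K z) i ⟩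
      E (Q u) i + E (K z) i ≈⟨ +-cong (E∘Q u i) (E∘K z i) ⟩
      0# + z i              ≈⟨ +-identityˡ _ ⟩
      z i                   ∎

    coordinates-of-0 : ∀ {u z} → Q u +ᵥ K z ≋ 0ᵥ → u ≋ 0ᵥ × z ≋ 0ᵥ
    coordinates-of-0 {u} {z} Qu+Kz≋0 =
      ≋-trans (≋-sym (S-coordinate u z)) (vanishes S-linear) ,
      ≋-trans (≋-sym (E-coordinate u z)) (vanishes E-linear)
      where
      vanishes : ∀ {p} {L : Vec N → Vec p} → Linear L → L (Q u +ᵥ K z) ≋ 0ᵥ
      vanishes lin = ≋-trans (preserves-≋ lin Qu+Kz≋0) (preserves-0 lin)

    liftBasis-isBasis :
      {W : Vec n → Set ℓ} → (∀ {u v} → u ≋ v → W u → W v) → W 0ᵥ →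
      {P : Vec N → Set ℓ} → (∀ {w} → W (S w) → P w) → (∀ {w} → P w → W (S w)) →
      ∀ {m} {b : Fin m → Vec n} → IsBasis W b → IsBasis P (liftBasis b)
    liftBasis-isBasis {W} W-cong W-0 {P} W⇒P P⇒W {m} {b} (b∈W , b-independent , b-spanning) =
      members , independent , spanning
      where
      members : ∀ j → P (liftBasis b j)
      members = All.++⁺ P (λ j → W⇒P (W-cong (≋-sym (S∘Q (b j))) (b∈W j)))
                          (λ r → W⇒P (W-cong (≋-sym (S∘K (unit r))) W-0))

      independent : ∀ x → lincomb F x (liftBasis b) ≋ 0ᵥ → x ≋ 0ᵥ
      independent x x·B≋0 with coordinates-of-0 (≋-trans (≋-sym (lincomb-liftBasis b x)) x·B≋0)
      ... | a·b≋0 , z≋0 = All-take-drop {P = _≈ 0#} m x (b-independent (take m x) a·b≋0) z≋0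

      spanning : ∀ w → P w → ∃ λ x → w ≋ lincomb F x (liftBasis b)
      spanning w w∈P with b-spanning (S w) (P⇒W w∈P)
      ... | a , Sw≋a·b = a ++ E w , λ y → begin
        w y
          ≈⟨ Q∘S+K∘E w y ⟨
        Q (S w) y + K (E w) y
          ≈⟨ +-congʳ (preserves-≋ Q-linear Sw≋a·b y) ⟩
        Q (lincomb F a b) y + K (E w) y
          ≈⟨ +-cong (preserves-≋ Q-linear (lincomb-congˡ b (≗⇒≋ (lookup-++ˡ a (E w)))) y)
                    (preserves-≋ K-linear (≗⇒≋ (lookup-++ʳ a (E w))) y) ⟨
        Q (lincomb F (take m (a ++ E w)) b) y + K (drop m (a ++ E w)) y
          ≈⟨ lincomb-liftBasis b (a ++ E w) y ⟨
        lincomb F (a ++ E w) (liftBasis b) y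
          ∎

  emptySplitting : Splitting {0} {0} (λ w → w) 0
  emptySplitting = record
    { E = λ w → w ; Q = λ u → u ; K = λ z → z
    ; S-linear = into-F⁰-linear _ ; E-linear = into-F⁰-linear _
    ; Q-linear = into-F⁰-linear _ ; K-linear = into-F⁰-linear _
    ; S∘Q = λ _ () ; S∘K = λ _ () ; E∘Q = λ _ () ; E∘K = λ _ () ; Q∘S+K∘E = λ _ () }

  -- The splitting of one block F^a (a ≥ 1) along its total sum:
  -- v = (Σ v, 0, …, 0) + (−Σ z, z) with z = (v₂,…,v_a).
  module Block where
    total : ∀ {a} → Vec a → Vec 1
    total v _ = fsum F v

    point : ∀ a → Vec 1 → Vec a
    point zero    u ()
    point (suc a) u zero    = u zero
    point (suc a) u (suc _) = 0#

    balanced : ∀ a → Vec (Nat.pred a) → Vec a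
    balanced zero    z ()
    balanced (suc a) z zero    = - fsum F z
    balanced (suc a) z (suc k) = z k

    rest : ∀ a → Vec a → Vec (Nat.pred a)
    rest zero    v ()
    rest (suc a) v k = v (suc k)

    total-linear : ∀ {a} → Linear (total {a})
    total-linear = record
      { preserves-≋ = λ u≋v _ → fsum-cong u≋v
      ; preserves-+ = λ u v _ → fsum-+ u v
      ; preserves-· = λ x u _ → fsum-· x u }

    point-linear : ∀ a → Linear (point a)
    point-linear zero    = into-F⁰-linear (point 0)
    point-linear (suc a) = record
      { preserves-≋ = λ { u≋v zero → u≋v zero ; u≋v (suc _) → refl }
      ; preserves-+ = λ { u v zero → refl ; u v (suc _) → sym (+-identityˡ 0#) }
      ; preserves-· = λ { x u zero → refl ; x u (suc _) → sym (zeroʳ x) } }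

    balanced-linear : ∀ a → Linear (balanced a)
    balanced-linear zero    = into-F⁰-linear (balanced 0)
    balanced-linear (suc a) = record
      { preserves-≋ = λ { u≋v zero → -‿cong (fsum-cong u≋v) ; u≋v (suc k) → u≋v k }
      ; preserves-+ = λ { u v zero → trans (-‿cong (fsum-+ u v)) (sym (-‿+-comm _ _))
                        ; u v (suc _) → refl }
      ; preserves-· = λ { x u zero → trans (-‿cong (fsum-· x u)) (-‿distribʳ-* x _)
                        ; x u (suc _) → refl } }

    rest-linear : ∀ a → Linear (rest a)
    rest-linear zero    = into-F⁰-linear (rest 0)
    rest-linear (suc a) = record
      { preserves-≋ = λ u≋v k → u≋v (suc k)
      ; preserves-+ = λ _ _ _ → refl
      ; preserves-· = λ _ _ _ → refl }

    blockSplitting : ∀ a → 1 Nat.≤ a → Splitting (total {a}) (Nat.pred a)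
    blockSplitting (suc a) _ = record
      { E = rest (suc a) ; Q = point (suc a) ; K = balanced (suc a)
      ; S-linear = total-linear ; E-linear = rest-linear (suc a)
      ; Q-linear = point-linear (suc a) ; K-linear = balanced-linear (suc a)
      ; S∘Q = λ { u zero → trans (+-congˡ (fsum-0 {a})) (+-identityʳ _) }
      ; S∘K = λ { z zero → -‿inverseˡ (fsum F z) }
      ; E∘Q = λ _ _ → refl
      ; E∘K = λ _ _ → refl
      ; Q∘S+K∘E = λ { w zero → Σ-minus-tail w ; w (suc _) → +-identityˡ _ } }
      where
      Σ-minus-tail : ∀ (w : Vec (suc a)) → fsum F w + - fsum F (w ∘ suc) ≈ w zero
      Σ-minus-tail w = begin
        (w zero + fsum F (w ∘ suc)) + - fsum F (w ∘ suc) ≈⟨ +-assoc _ _ _ ⟩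
        w zero + (fsum F (w ∘ suc) + - fsum F (w ∘ suc)) ≈⟨ +-congˡ (-‿inverseʳ _) ⟩
        w zero + 0#                                      ≈⟨ +-identityʳ _ ⟩
        w zero                                           ∎

module BlowupWeightings {c ℓ : Level} (F : Field c ℓ) where

  open Field F hiding (zero)
  open LinearAlgebra F
  open import Data.Vec.Functional.Relation.Binary.Equality.Setoid setoid using (_≋_)
  open import Relation.Binary.Reasoning.Setoid setoid

  fibreSum : ∀ {n} (t : Fin n → ℕ) → Vec (sumℕ t) → Vec n
  fibreSum {zero}  t = λ w → w
  fibreSum {suc n} t = Block.total ⊕ fibreSum (t ∘ suc)

  blowupSplitting : ∀ {n} (t : Fin n → ℕ) → (∀ i → 1 Nat.≤ t i) → Splitting (fibreSum t) (excess t)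
  blowupSplitting {zero}  t t≥1 = emptySplitting
  blowupSplitting {suc n} t t≥1 =
    Block.blockSplitting (t zero) (t≥1 zero) ⊕ˢ blowupSplitting (t ∘ suc) (t≥1 ∘ suc)

  weightOf-cong : ∀ {n} {w w′ : Vec n} (M : VSubset n) → w ≋ w′ → weightOf F w M ≈ weightOf F w′ M
  weightOf-cong M w≋w′ = fsum-cong (λ k → select (M k) (w≋w′ k))
    where
    select : ∀ b {x y} → x ≈ y → (if b then x else 0#) ≈ (if b then y else 0#)
    select true  x≈y = x≈y
    select false _   = refl

  weightOf-0 : ∀ {n} (M : VSubset n) → weightOf F 0ᵥ M ≈ 0#
  weightOf-0 {n} M = trans (fsum-cong (λ k → select (M k))) (fsum-0 {n})
    where
    select : ∀ b → (if b then 0# else 0#) ≈ 0#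
    select true  = refl
    select false = refl

  weightOf-≗ : ∀ {n} (w : Vec n) {M M′ : VSubset n} → M ≗ M′ → weightOf F w M ≈ weightOf F w M′
  weightOf-≗ w M≗M′ = fsum-cong (λ k → reflexive (≡.cong (λ b → if b then w k else 0#) (M≗M′ k)))

  fsum-select : ∀ {a} b (f : Vec a) →
                fsum F (λ k → if b then f k else 0#) ≈ (if b then fsum F f else 0#)
  fsum-select true  f = refl
  fsum-select {a} false f = fsum-0 {a}

  weightOf-preimage : ∀ {n} (t : Fin n → ℕ) (w : Vec (sumℕ t)) (M : VSubset n) →
                      weightOf F w (M ∘ origin t) ≈ weightOf F (fibreSum t w) M
  weightOf-preimage {zero}  t w M = refl
  weightOf-preimage {suc n} t w M = begin
    weightOf F w (M ∘ origin t)
      ≈⟨ fsum-++ (t zero) _ ⟩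
    weightOf F w₁ (M ∘ origin t ∘ (_↑ˡ _)) + weightOf F w₂ (M ∘ origin t ∘ (t zero ↑ʳ_))
      ≈⟨ +-cong (weightOf-≗ w₁ (≡.cong M ∘ origin-↑ˡ t)) (weightOf-≗ w₂ (≡.cong M ∘ origin-↑ʳ t)) ⟩
    weightOf F w₁ (λ _ → M zero) + weightOf F w₂ (M ∘ suc ∘ origin (t ∘ suc))
      ≈⟨ +-cong (fsum-select (M zero) w₁) (weightOf-preimage (t ∘ suc) w₂ (M ∘ suc)) ⟩
    weightOf F (fibreSum t w) M
      ∎
    where
    w₁ = take (t zero) w
    w₂ = drop (t zero) w

  wellCovered-cong : ∀ {n} (G : Graph n) {w w′ : Vec n} →
                     w ≋ w′ → WellCovered F G w → WellCovered F G w′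
  wellCovered-cong G w≋w′ w-wc M M′ M-max M′-max =
    trans (sym (weightOf-cong M w≋w′)) (trans (w-wc M M′ M-max M′-max) (weightOf-cong M′ w≋w′))

  wellCovered-0 : ∀ {n} (G : Graph n) → WellCovered F G 0ᵥ
  wellCovered-0 G M M′ _ _ = trans (weightOf-0 M) (sym (weightOf-0 M′))

  module _ {n} (G : Graph n) (t : Fin n → ℕ) (t≥1 : ∀ i → 1 Nat.≤ t i) where
    -- blowup G t is, by definition, the pullback of G along origin t
    open Pullback G (origin t) (firstCopy t t≥1) (origin-firstCopy t t≥1)

    wellCovered⇒fibreSum : ∀ w → WellCovered F (blowup G t) w → WellCovered F G (fibreSum t w)
    wellCovered⇒fibreSum w w-wc M M′ M-max M′-max = begin
      weightOf F (fibreSum t w) M   ≈⟨ weightOf-preimage t w M ⟨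
      weightOf F w (M ∘ origin t)   ≈⟨ w-wc _ _ (preimage-maximal M-max) (preimage-maximal M′-max) ⟩
      weightOf F w (M′ ∘ origin t)  ≈⟨ weightOf-preimage t w M′ ⟩
      weightOf F (fibreSum t w) M′  ∎

    fibreSum⇒wellCovered : ∀ w → WellCovered F G (fibreSum t w) → WellCovered F (blowup G t) w
    fibreSum⇒wellCovered w Sw-wc M M′ M-max M′-max = begin
      weightOf F w M                                ≈⟨ weightOf-≗ w (preimage-restriction M-max) ⟩
      weightOf F w (restriction M-max ∘ origin t)   ≈⟨ weightOf-preimage t w _ ⟩
      weightOf F (fibreSum t w) (restriction M-max)
        ≈⟨ Sw-wc _ _ (restriction-maximal M-max) (restriction-maximal M′-max) ⟩
      weightOf F (fibreSum t w) (restriction M′-max) ≈⟨ weightOf-preimage t w _ ⟨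
      weightOf F w (restriction M′-max ∘ origin t)   ≈⟨ weightOf-≗ w (preimage-restriction M′-max) ⟨
      weightOf F w M′                                ∎

    open BasisTransfer (blowupSplitting t t≥1) using (liftBasis; liftBasis-isBasis)

    blowup-basis : ∀ {m} {b : Fin m → Vec n} → IsBasis (WellCovered F G) b →
                   IsBasis (WellCovered F (blowup G t)) (liftBasis b)
    blowup-basis = liftBasis-isBasis (wellCovered-cong G) (wellCovered-0 G)
                                     (fibreSum⇒wellCovered _) (wellCovered⇒fibreSum _)

-- From here on _+_ is addition of natural numbers.
open Nat using (_+_; _∸_; _≤_; pred; >-nonZero)
open import Data.Nat.Properties using (+-suc; +-assoc; suc-pred; m+n∸n≡m)

excess+n≡sum : ∀ {n} (t : Fin n → ℕ) → (∀ i → 1 ≤ t i) → excess t + n ≡ sumℕ t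
excess+n≡sum {zero}  t t≥1 = ≡.refl
excess+n≡sum {suc n} t t≥1 = begin
  (p + excess (t ∘ suc)) + suc n   ≡⟨ +-suc _ n ⟩
  suc ((p + excess (t ∘ suc)) + n) ≡⟨ ≡.cong suc (+-assoc p _ n) ⟩
  suc (p + (excess (t ∘ suc) + n)) ≡⟨ ≡.cong (λ s → suc (p + s)) induction ⟩
  suc p + sumℕ (t ∘ suc)           ≡⟨ ≡.cong (_+ sumℕ (t ∘ suc)) t₀≡suc-p ⟨
  sumℕ t                            ∎
  where
  open ≡.≡-Reasoning
  p = pred (t zero)
  induction : excess (t ∘ suc) + n ≡ sumℕ (t ∘ suc)
  induction = excess+n≡sum (t ∘ suc) (t≥1 ∘ suc)
  t₀≡suc-p : t zero ≡ suc p
  t₀≡suc-p = ≡.sym (suc-pred (t zero) {{>-nonZero (t≥1 zero)}})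

blowup-dimension : ∀ {n} m (t : Fin n → ℕ) → (∀ i → 1 ≤ t i) → (m + sumℕ t) ∸ n ≡ m + excess t
blowup-dimension {n} m t t≥1 = begin
  (m + sumℕ t) ∸ n            ≡⟨ ≡.cong (λ s → (m + s) ∸ n) (excess+n≡sum t t≥1) ⟨
  (m + (excess t + n)) ∸ n    ≡⟨ ≡.cong (_∸ n) (+-assoc m (excess t) n) ⟨
  ((m + excess t) + n) ∸ n    ≡⟨ m+n∸n≡m (m + excess t) n ⟩
  m + excess t                ∎
  where open ≡.≡-Reasoning

open BlowupWeightings using (blowup-basis)

mainTheorem7 : ∀ {c ℓ : Level} (F : Field c ℓ) (n : ℕ) (G : Graph n) (m : ℕ) →
    WcDim F G m →
    (t : Fin n → ℕ) → (∀ i → 1 ≤ t i) →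
    WcDim F (blowup G t) ((m + sumℕ t) ∸ n)
mainTheorem7 F n G m (_ , b-basis) t t≥1 =
  ≡.subst (WcDim F (blowup G t)) (≡.sym (blowup-dimension m t t≥1))
    (_ , blowup-basis F G t t≥1 b-basis)
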